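{- Let $n\ge 1$ and let $P=(p_{ij})\in\{0,1\}^{n\times n}$ be nonsingular such that the simplex $S=\mathrm{conv}\{0,p_1,\dots,p_n\}$ (where $p_1,\dots,p_n$ are the columns of $P$) is acute. Write $Q=(q_{ij})=P^{ -\top}$ (the transpose of the inverse of $P$). Then for all $i,j$, \[ q_{ij}>0 \iff p_{ij}=1 \quad\text{and}\quad q_{ij}<0 \iff p_{ij}=0 .\] Moreover, defining the nonnegative matrices $C=\tfrac12(|Q|-Q)$ and $D=\tfrac12(|Q|+Q)$, where $|Q|$ denotes the matrix of entrywise absolute values of $Q$, we have $Q=D-C$, where $D$ is doubly stochastic and $C$ is row-substochastic.
   Context: A $0/1$-simplex is the convex hull of $n+1$ affinely independent points of $\{0,1\}^n$ (vertices of the unit cube $I^n=[0,1]^n$). The dihedral angle between two facets of an $n$-simplex is $\pi$ minus the angle between their inward unit normals. A simplex is acute if all its dihedral angles are less than $\pi/2$. A nonnegative matrix is doubly stochastic if all its row and column sums equal $1$, and row-substochastic if all its row sums are at most $1$. -}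

module Defs where

open import Data.Nat using (ℕ; zero; suc)
open import Data.Fin using (Fin; zero; suc)
open import Data.Bool using (Bool; true; false)
open import Data.Rational using (ℚ; 0ℚ; 1ℚ; ½; _+_; _-_; _*_; ∣_∣; _<_; _≤_)
open import Data.Product using (_×_)
open import Relation.Binary.PropositionalEquality using (_≡_; _≢_)
open import Relation.Nullary using (¬_)

Vecℚ : ℕ → Set
Vecℚ n = Fin n → ℚ

Matℚ : ℕ → Set
Matℚ n = Fin n → Fin n → ℚ

Σ : (n : ℕ) → (Fin n → ℚ) → ℚ
Σ zero    f = 0ℚ
Σ (suc n) f = f zero + Σ n (λ i → f (suc i))

_·_ : {n : ℕ} → Vecℚ n → Vecℚ n → ℚ
_·_ {n} u v = Σ n (λ k → u k * v k)

_⊖_ : {n : ℕ} → Vecℚ n → Vecℚ n → Vecℚ n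
(u ⊖ v) k = u k - v k

bℚ : Bool → ℚ
bℚ true  = 1ℚ
bℚ false = 0ℚ

δ : {n : ℕ} → Fin n → Fin n → ℚ
δ zero    zero    = 1ℚ
δ zero    (suc j) = 0ℚ
δ (suc i) zero    = 0ℚ
δ (suc i) (suc j) = δ i j

-- A simplex in ℚ^n given by its m+1 vertices v : Fin (suc m) → ℚ^n.
-- u is an inward normal of the facet opposite vertex a: u is orthogonal
-- to the facet (u·(v b - v c) = 0 for all vertices b, c of the facet) and
-- points into the simplex (u·(v a - v b) > 0 for vertices b of the facet).
InwardNormal : {n m : ℕ} → (Fin (suc m) → Vecℚ n) → Fin (suc m) → Vecℚ n → Set
InwardNormal v a u =
  ((b c : _) → b ≢ a → c ≢ a → u · (v b ⊖ v c) ≡ 0ℚ) ×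
  ((b : _) → b ≢ a → 0ℚ < u · (v a ⊖ v b))

-- Acute: every dihedral angle  π - ∠(u,w)  (u, w inward normals of two
-- distinct facets) is < π/2, i.e. ∠(u,w) > π/2, i.e. u·w < 0.
Acute : {n m : ℕ} → (Fin (suc m) → Vecℚ n) → Set
Acute v = (a b : _) → a ≢ b → (u w : _) →
  InwardNormal v a u → InwardNormal v b w → u · w < 0ℚ

-- The vertices 0, p_1, ..., p_n of conv{0, p_1, ..., p_n}, p_j = column j of P
simplexVerts : {n : ℕ} → (Fin n → Fin n → Bool) → Fin (suc n) → Vecℚ n
simplexVerts P zero    k = 0ℚ
simplexVerts P (suc j) k = bℚ (P k j)

-- Q = P^{-T}: Qᵀ is a two-sided inverse of P
IsInvTranspose : {n : ℕ} → (Fin n → Fin n → Bool) → Matℚ n → Set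
IsInvTranspose {n} P Q =
  ((i j : Fin n) → Σ n (λ k → Q k i * bℚ (P k j)) ≡ δ i j) ×
  ((i j : Fin n) → Σ n (λ k → bℚ (P i k) * Q j k) ≡ δ i j)

Cmat : {n : ℕ} → Matℚ n → Matℚ n
Cmat Q i j = ½ * (∣ Q i j ∣ - Q i j)

Dmat : {n : ℕ} → Matℚ n → Matℚ n
Dmat Q i j = ½ * (∣ Q i j ∣ + Q i j)

DoublyStochastic : {n : ℕ} → Matℚ n → Set
DoublyStochastic {n} M =
  ((i j : Fin n) → 0ℚ ≤ M i j) ×
  ((i : Fin n) → Σ n (λ j → M i j) ≡ 1ℚ) ×
  ((j : Fin n) → Σ n (λ i → M i j) ≡ 1ℚ)

RowSubstochastic : {n : ℕ} → Matℚ n → Set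
RowSubstochastic {n} M =
  ((i j : Fin n) → 0ℚ ≤ M i j) ×
  ((i : Fin n) → Σ n (λ j → M i j) ≤ 1ℚ)

module Submission where

-- Since Qᵀ P = I, the column q_j is constant (0) on every vertex of S
-- except p_j, where it is 1: q_j is an inward normal of the facet opposite
-- p_j.  Likewise u₀ = -(q_1 + ... + q_n) is an inward normal of the facet
-- opposite 0.  Acuteness turns the inner products of these normals into
-- signs: the Gram matrix G = QᵀQ has negative off-diagonal entries, and
-- u₀·q_j < 0 says that the column sums of G are positive.  As Q = P G,
-- row i of Q is a 0/1-combination of the rows of G, and for such a
-- "Z-matrix with positive column sums" the entry (Σ_k b_k G_kj) is positive
-- when b_j = 1 and negative when b_j = 0 (and b ≠ 0).  This is the sign
-- pattern; it shows that D = ½(|Q|+Q) is the Hadamard product P∘Q, whose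
-- row and column sums are the diagonal entries of P Qᵀ = Qᵀ P = I, and
-- C = D - Q has row sums 1 - Σ_j q_ij ≤ 1 because Σ_j q_ij ≥ 0.

open import Defs
open import Data.Nat using (ℕ; zero; suc; _≤_)
open import Data.Fin using (Fin; zero; suc) renaming (_≟_ to _≟ᶠ_)
open import Data.Fin.Properties using (suc-injective)
open import Data.Bool using (Bool; true; false)
open import Data.Rational
  using (ℚ; 0ℚ; 1ℚ; ½; _+_; _-_; _*_; -_; ∣_∣; _<_)
  renaming (_≤_ to _≤ℚ_)
open import Data.Rational.Properties
open import Data.Rational.Solver using (module +-*-Solver)
open import Data.Product using (_×_; _,_; proj₁; proj₂; ∃-syntax)
open import Data.Sum using (inj₁; inj₂)
open import Data.Empty using (⊥-elim)
open import Relation.Nullary using (yes; no)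
open import Function.Bundles using (_⇔_; mk⇔)
open import Relation.Binary.PropositionalEquality
  using (_≡_; _≢_; refl; sym; trans; cong; cong₂; subst; module ≡-Reasoning)
open ≡-Reasoning
open +-*-Solver

Σ-cong : ∀ n {f g : Fin n → ℚ} → (∀ k → f k ≡ g k) → Σ n f ≡ Σ n g
Σ-cong zero    e = refl
Σ-cong (suc n) e = cong₂ _+_ (e zero) (Σ-cong n (λ k → e (suc k)))

Σ-zero : ∀ n → Σ n (λ _ → 0ℚ) ≡ 0ℚ
Σ-zero zero    = refl
Σ-zero (suc n) = trans (cong (0ℚ +_) (Σ-zero n)) (+-identityʳ 0ℚ)

Σ-+ : ∀ n (f g : Fin n → ℚ) → Σ n (λ k → f k + g k) ≡ Σ n f + Σ n g
Σ-+ zero    f g = refl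
Σ-+ (suc n) f g = begin
  (f zero + g zero) + Σ n (λ k → f (suc k) + g (suc k))
    ≡⟨ cong ((f zero + g zero) +_) (Σ-+ n (λ k → f (suc k)) (λ k → g (suc k))) ⟩
  (f zero + g zero) + (Σ n (λ k → f (suc k)) + Σ n (λ k → g (suc k)))
    ≡⟨ interchange (f zero) (g zero) _ _ ⟩
  (f zero + Σ n (λ k → f (suc k))) + (g zero + Σ n (λ k → g (suc k))) ∎
  where
  interchange : ∀ a b c d → (a + b) + (c + d) ≡ (a + c) + (b + d)
  interchange = solve 4 (λ a b c d → (a :+ b) :+ (c :+ d) := (a :+ c) :+ (b :+ d)) refl

Σ-*ˡ : ∀ n c (f : Fin n → ℚ) → Σ n (λ k → c * f k) ≡ c * Σ n f
Σ-*ˡ zero    c f = sym (*-zeroʳ c)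
Σ-*ˡ (suc n) c f = trans (cong (c * f zero +_) (Σ-*ˡ n c (λ k → f (suc k))))
  (sym (*-distribˡ-+ c (f zero) (Σ n (λ k → f (suc k)))))

Σ-*ʳ : ∀ n c (f : Fin n → ℚ) → Σ n (λ k → f k * c) ≡ Σ n f * c
Σ-*ʳ n c f = trans (Σ-cong n (λ k → *-comm (f k) c))
  (trans (Σ-*ˡ n c f) (*-comm c (Σ n f)))

Σ-neg : ∀ n (f : Fin n → ℚ) → Σ n (λ k → - f k) ≡ - Σ n f
Σ-neg zero    f = refl
Σ-neg (suc n) f = trans (cong (- f zero +_) (Σ-neg n (λ k → f (suc k))))
  (sym (neg-distrib-+ (f zero) (Σ n (λ k → f (suc k)))))

Σ-- : ∀ n (f g : Fin n → ℚ) → Σ n (λ k → f k - g k) ≡ Σ n f - Σ n g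
Σ-- n f g = trans (Σ-+ n f (λ k → - g k)) (cong (Σ n f +_) (Σ-neg n g))

Σ-swap : ∀ n m (f : Fin n → Fin m → ℚ) →
  Σ n (λ i → Σ m (λ j → f i j)) ≡ Σ m (λ j → Σ n (λ i → f i j))
Σ-swap zero    m f = sym (Σ-zero m)
Σ-swap (suc n) m f = begin
  Σ m (f zero) + Σ n (λ i → Σ m (λ j → f (suc i) j))
    ≡⟨ cong (Σ m (f zero) +_) (Σ-swap n m (λ i j → f (suc i) j)) ⟩
  Σ m (f zero) + Σ m (λ j → Σ n (λ i → f (suc i) j))
    ≡⟨ Σ-+ m (f zero) (λ j → Σ n (λ i → f (suc i) j)) ⟨
  Σ m (λ j → Σ (suc n) (λ i → f i j)) ∎

δ-diag : ∀ {n} (i : Fin n) → δ i i ≡ 1ℚ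
δ-diag zero    = refl
δ-diag (suc i) = δ-diag i

δ-off : ∀ {n} (i j : Fin n) → i ≢ j → δ i j ≡ 0ℚ
δ-off zero    zero    i≢j = ⊥-elim (i≢j refl)
δ-off zero    (suc j) _   = refl
δ-off (suc i) zero    _   = refl
δ-off (suc i) (suc j) i≢j = δ-off i j (λ i≡j → i≢j (cong suc i≡j))

Σ-δ : ∀ n (i : Fin n) (f : Fin n → ℚ) → Σ n (λ m → δ i m * f m) ≡ f i
Σ-δ (suc n) zero f = begin
  1ℚ * f zero + Σ n (λ m → 0ℚ * f (suc m))
    ≡⟨ cong₂ _+_ (*-identityˡ (f zero))
                 (trans (Σ-cong n (λ m → *-zeroˡ (f (suc m)))) (Σ-zero n)) ⟩
  f zero + 0ℚ
    ≡⟨ +-identityʳ (f zero) ⟩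
  f zero ∎
Σ-δ (suc n) (suc i) f =
  trans (cong₂ _+_ (*-zeroˡ (f zero)) (Σ-δ n i (λ m → f (suc m))))
        (+-identityˡ (f (suc i)))

Σ-δ-column : ∀ n (k : Fin n) → Σ n (λ l → δ l k) ≡ 1ℚ
Σ-δ-column (suc n) zero    = trans (cong (1ℚ +_) (Σ-zero n)) (+-identityʳ 1ℚ)
Σ-δ-column (suc n) (suc k) = trans (+-identityˡ _) (Σ-δ-column n k)

Σ-mono : ∀ n {f g : Fin n → ℚ} → (∀ k → f k ≤ℚ g k) → Σ n f ≤ℚ Σ n g
Σ-mono zero    f≤g = ≤-refl
Σ-mono (suc n) f≤g = +-mono-≤ (f≤g zero) (Σ-mono n (λ k → f≤g (suc k)))

Σ-nonneg : ∀ n {f : Fin n → ℚ} → (∀ k → 0ℚ ≤ℚ f k) → 0ℚ ≤ℚ Σ n f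
Σ-nonneg n {f} 0≤f = subst (_≤ℚ Σ n f) (Σ-zero n) (Σ-mono n 0≤f)

Σ-negative : ∀ n {f : Fin n → ℚ} → (∀ k → f k ≤ℚ 0ℚ) →
  (k₀ : Fin n) → f k₀ < 0ℚ → Σ n f < 0ℚ
Σ-negative (suc n) {f} f≤0 zero f₀<0 =
  subst (Σ (suc n) f <_) (+-identityʳ 0ℚ)
    (+-mono-<-≤ f₀<0 (subst (Σ n (λ k → f (suc k)) ≤ℚ_) (Σ-zero n)
                              (Σ-mono n (λ k → f≤0 (suc k)))))
Σ-negative (suc n) {f} f≤0 (suc k₀) fk₀<0 =
  subst (Σ (suc n) f <_) (+-identityʳ 0ℚ)
    (+-mono-≤-< (f≤0 zero) (Σ-negative n (λ k → f≤0 (suc k)) k₀ fk₀<0))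

bℚ-true : ∀ {b} x → b ≡ true → bℚ b * x ≡ x
bℚ-true x refl = *-identityˡ x

bℚ-false : ∀ {b} x → b ≡ false → bℚ b * x ≡ 0ℚ
bℚ-false x refl = *-zeroˡ x

bℚ-nonpos : ∀ b {x} → x ≤ℚ 0ℚ → bℚ b * x ≤ℚ 0ℚ
bℚ-nonpos true  {x} x≤0 = subst (_≤ℚ 0ℚ) (sym (*-identityˡ x)) x≤0
bℚ-nonpos false {x} _   = ≤-reflexive (*-zeroˡ x)

bℚ-nonpos-≥ : ∀ b {x} → x ≤ℚ 0ℚ → x ≤ℚ bℚ b * x
bℚ-nonpos-≥ true  {x} _   = ≤-reflexive (sym (*-identityˡ x))
bℚ-nonpos-≥ false {x} x≤0 = subst (x ≤ℚ_) (sym (*-zeroˡ x)) x≤0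

bℚ-nonneg : ∀ b {x} → 0ℚ ≤ℚ x → 0ℚ ≤ℚ bℚ b * x
bℚ-nonneg true  {x} 0≤x = subst (0ℚ ≤ℚ_) (sym (*-identityˡ x)) 0≤x
bℚ-nonneg false {x} _   = ≤-reflexive (sym (*-zeroˡ x))

row-has-one : ∀ n (b : Fin n → Bool) (g : Fin n → ℚ) →
  Σ n (λ k → bℚ (b k) * g k) ≡ 1ℚ → ∃[ k ] b k ≡ true
row-has-one zero    b g 0≡1 = ⊥-elim (1≢0 (sym 0≡1))
row-has-one (suc n) b g sum≡1 with b zero in b₀
... | true  = zero , b₀
... | false =
  let (k , bk) = row-has-one n (λ k → b (suc k)) (λ k → g (suc k)) tail≡1
  in suc k , bk
  where
  tail : ℚ
  tail = Σ n (λ k → bℚ (b (suc k)) * g (suc k))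
  tail≡1 : tail ≡ 1ℚ
  tail≡1 = begin
    tail                  ≡⟨ +-identityˡ tail ⟨
    0ℚ + tail             ≡⟨ cong (_+ tail) (*-zeroˡ (g zero)) ⟨
    0ℚ * g zero + tail    ≡⟨ sum≡1 ⟩
    1ℚ ∎

sign-pattern : ∀ b x → (b ≡ true → 0ℚ < x) → (b ≡ false → x < 0ℚ) →
  ((0ℚ < x) ⇔ (b ≡ true)) × ((x < 0ℚ) ⇔ (b ≡ false))
sign-pattern true  x pos neg = mk⇔ (λ _ → refl) pos ,
  mk⇔ (λ x<0 → ⊥-elim (<-asym x<0 (pos refl))) neg
sign-pattern false x pos neg =
  mk⇔ (λ 0<x → ⊥-elim (<-asym 0<x (neg refl))) pos , mk⇔ (λ _ → refl) neg

dot-⊖ : ∀ {n} (u x y : Vecℚ n) → u · (x ⊖ y) ≡ (u · x) - (u · y)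
dot-⊖ {n} u x y = begin
  Σ n (λ k → u k * (x k - y k))
    ≡⟨ Σ-cong n (λ k → *-distribˡ-+ (u k) (x k) (- y k)) ⟩
  Σ n (λ k → u k * x k + u k * (- y k))
    ≡⟨ Σ-+ n (λ k → u k * x k) (λ k → u k * (- y k)) ⟩
  (u · x) + Σ n (λ k → u k * (- y k))
    ≡⟨ cong ((u · x) +_) (Σ-cong n (λ k → neg-distribʳ-* (u k) (y k))) ⟨
  (u · x) + Σ n (λ k → - (u k * y k))
    ≡⟨ cong ((u · x) +_) (Σ-neg n (λ k → u k * y k)) ⟩
  (u · x) - (u · y) ∎

inward-normal : ∀ {n m} (v : Fin (suc m) → Vecℚ n) (a : Fin (suc m))
  (u : Vecℚ n) (c : ℚ) →
  (∀ b → b ≢ a → u · v b ≡ c) → u · v a ≡ c + 1ℚ → InwardNormal v a u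
inward-normal v a u c on-facet at-a = orthogonal , inward
  where
  orthogonal : ∀ b d → b ≢ a → d ≢ a → u · (v b ⊖ v d) ≡ 0ℚ
  orthogonal b d b≢a d≢a = begin
    u · (v b ⊖ v d)         ≡⟨ dot-⊖ u (v b) (v d) ⟩
    (u · v b) - (u · v d)   ≡⟨ cong₂ _-_ (on-facet b b≢a) (on-facet d d≢a) ⟩
    c - c                   ≡⟨ +-inverseʳ c ⟩
    0ℚ ∎
  step : ∀ c → (c + 1ℚ) - c ≡ 1ℚ
  step = solve 1 (λ c → (c :+ con 1ℚ) :- c := con 1ℚ) refl
  inward : ∀ b → b ≢ a → 0ℚ < u · (v a ⊖ v b)
  inward b b≢a = subst (0ℚ <_) (sym (begin
    u · (v a ⊖ v b)         ≡⟨ dot-⊖ u (v a) (v b) ⟩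
    (u · v a) - (u · v b)   ≡⟨ cong₂ _-_ at-a (on-facet b b≢a) ⟩
    (c + 1ℚ) - c            ≡⟨ step c ⟩
    1ℚ ∎)) (positive⁻¹ 1ℚ)

module ZMatrixSigns {n : ℕ} (G : Matℚ n)
  (off-diagonal : ∀ k j → k ≢ j → G k j < 0ℚ)
  (column-sums : ∀ j → 0ℚ < Σ n (λ k → G k j)) where

  combination-pos : (b : Fin n → Bool) (j : Fin n) → b j ≡ true →
    0ℚ < Σ n (λ k → bℚ (b k) * G k j)
  combination-pos b j bj = <-≤-trans (column-sums j) (Σ-mono n termwise)
    where
    termwise : ∀ k → G k j ≤ℚ bℚ (b k) * G k j
    termwise k with k ≟ᶠ j
    ... | yes refl = ≤-reflexive (sym (bℚ-true (G k j) bj))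
    ... | no  k≢j  = bℚ-nonpos-≥ (b k) (<⇒≤ (off-diagonal k j k≢j))

  combination-neg : (b : Fin n → Bool) (j k₀ : Fin n) → b j ≡ false →
    b k₀ ≡ true → Σ n (λ k → bℚ (b k) * G k j) < 0ℚ
  combination-neg b j k₀ bj bk₀ = Σ-negative n termwise k₀
    (subst (_< 0ℚ) (sym (bℚ-true (G k₀ j) bk₀)) (off-diagonal k₀ j k₀≢j))
    where
    termwise : ∀ k → bℚ (b k) * G k j ≤ℚ 0ℚ
    termwise k with k ≟ᶠ j
    ... | yes refl = ≤-reflexive (bℚ-false (G k j) bj)
    ... | no  k≢j  = bℚ-nonpos (b k) (<⇒≤ (off-diagonal k j k≢j))
    k₀≢j : k₀ ≢ j
    k₀≢j refl with trans (sym bk₀) bj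
    ... | ()

pos-part : ℚ → ℚ
pos-part x = ½ * (∣ x ∣ + x)

neg-part : ℚ → ℚ
neg-part x = ½ * (∣ x ∣ - x)

private
  half-double : ∀ x → ½ * (x + x) ≡ x
  half-double = solve 1 (λ x → con ½ :* (x :+ x) := x) refl

  half-cancel : ∀ x → ½ * (- x + x) ≡ 0ℚ
  half-cancel = solve 1 (λ x → con ½ :* (:- x :+ x) := con 0ℚ) refl

  half-diff : ∀ x → ½ * (x - x) ≡ 0ℚ
  half-diff = solve 1 (λ x → con ½ :* (x :- x) := con 0ℚ) refl

  half-neg-double : ∀ x → ½ * (- x - x) ≡ - x
  half-neg-double = solve 1 (λ x → con ½ :* (:- x :- x) := :- x) refl

pos-part-of-pos : ∀ {x} → 0ℚ < x → pos-part x ≡ x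
pos-part-of-pos {x} 0<x =
  trans (cong (λ a → ½ * (a + x)) (0≤p⇒∣p∣≡p (<⇒≤ 0<x))) (half-double x)

pos-part-of-neg : ∀ {x} → x < 0ℚ → pos-part x ≡ 0ℚ
pos-part-of-neg {x} x<0 with ∣p∣≡p∨∣p∣≡-p x
... | inj₁ ∣x∣≡x  = ⊥-elim (<-irrefl refl (<-≤-trans x<0 (∣p∣≡p⇒0≤p ∣x∣≡x)))
... | inj₂ ∣x∣≡-x = trans (cong (λ a → ½ * (a + x)) ∣x∣≡-x) (half-cancel x)

pos-part-nonneg : ∀ x → 0ℚ ≤ℚ pos-part x
pos-part-nonneg x with ∣p∣≡p∨∣p∣≡-p x
... | inj₁ ∣x∣≡x  = subst (0ℚ ≤ℚ_)
  (sym (trans (cong (λ a → ½ * (a + x)) ∣x∣≡x) (half-double x))) (∣p∣≡p⇒0≤p ∣x∣≡x)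
... | inj₂ ∣x∣≡-x = ≤-reflexive
  (sym (trans (cong (λ a → ½ * (a + x)) ∣x∣≡-x) (half-cancel x)))

neg-part-nonneg : ∀ x → 0ℚ ≤ℚ neg-part x
neg-part-nonneg x with ∣p∣≡p∨∣p∣≡-p x
... | inj₁ ∣x∣≡x  = ≤-reflexive
  (sym (trans (cong (λ a → ½ * (a - x)) ∣x∣≡x) (half-diff x)))
... | inj₂ ∣x∣≡-x = subst (0ℚ ≤ℚ_)
  (sym (trans (cong (λ a → ½ * (a - x)) ∣x∣≡-x) (half-neg-double x)))
  (subst (0ℚ ≤ℚ_) ∣x∣≡-x (0≤∣p∣ x))

pos-neg-decomposition : ∀ x → x ≡ pos-part x - neg-part x
pos-neg-decomposition x = identity ∣ x ∣ x
  where
  identity : ∀ a x → x ≡ ½ * (a + x) - ½ * (a - x)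
  identity = solve 2 (λ a x → x := con ½ :* (a :+ x) :- con ½ :* (a :- x)) refl

neg-part≡pos-part-minus : ∀ x → neg-part x ≡ pos-part x - x
neg-part≡pos-part-minus x = begin
  neg-part x                          ≡⟨ identity (pos-part x) (neg-part x) ⟨
  pos-part x - (pos-part x - neg-part x)
    ≡⟨ cong (λ y → pos-part x - y) (pos-neg-decomposition x) ⟨
  pos-part x - x ∎
  where
  identity : ∀ d c → d - (d - c) ≡ c
  identity = solve 2 (λ d c → d :- (d :- c) := c) refl

module AcuteZeroOneSimplex (n : ℕ) (P : Fin n → Fin n → Bool) (Q : Matℚ n)
  (inverse : IsInvTranspose P Q) (acute : Acute (simplexVerts P)) where

  QᵀP≡I : (i j : Fin n) → Σ n (λ k → Q k i * bℚ (P k j)) ≡ δ i j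
  QᵀP≡I = proj₁ inverse

  PQᵀ≡I : (i j : Fin n) → Σ n (λ k → bℚ (P i k) * Q j k) ≡ δ i j
  PQᵀ≡I = proj₂ inverse

  q : Fin n → Vecℚ n
  q j m = Q m j

  u₀ : Vecℚ n
  u₀ m = - Σ n (λ l → Q m l)

  u₀-dot : ∀ x → u₀ · x ≡ - Σ n (λ l → q l · x)
  u₀-dot x = begin
    Σ n (λ m → (- Σ n (λ l → Q m l)) * x m)
      ≡⟨ Σ-cong n (λ m → neg-distribˡ-* (Σ n (λ l → Q m l)) (x m)) ⟨
    Σ n (λ m → - (Σ n (λ l → Q m l) * x m))
      ≡⟨ Σ-cong n (λ m → cong -_ (Σ-*ʳ n (x m) (λ l → Q m l))) ⟨
    Σ n (λ m → - Σ n (λ l → Q m l * x m))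
      ≡⟨ Σ-neg n _ ⟩
    - Σ n (λ m → Σ n (λ l → Q m l * x m))
      ≡⟨ cong -_ (Σ-swap n n _) ⟩
    - Σ n (λ l → q l · x) ∎

  vanishes-at-origin : ∀ u → u · simplexVerts P zero ≡ 0ℚ
  vanishes-at-origin u = trans (Σ-cong n (λ k → *-zeroʳ (u k))) (Σ-zero n)

  -- q_j·p_k = δ_jk (from QᵀP = I) and q_j·0 = 0.
  q-normal : ∀ j → InwardNormal (simplexVerts P) (suc j) (q j)
  q-normal j = inward-normal (simplexVerts P) (suc j) (q j) 0ℚ on-facet
    (trans (QᵀP≡I j j) (trans (δ-diag j) (sym (+-identityˡ 1ℚ))))
    where
    on-facet : ∀ b → b ≢ suc j → q j · simplexVerts P b ≡ 0ℚ
    on-facet zero    _ = vanishes-at-origin (q j)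
    on-facet (suc k) k≢j =
      trans (QᵀP≡I j k) (δ-off j k (λ j≡k → k≢j (cong suc (sym j≡k))))

  -- u₀·p_k = -Σ_l δ_lk = -1 and u₀·0 = 0.
  u₀-normal : InwardNormal (simplexVerts P) zero u₀
  u₀-normal = inward-normal (simplexVerts P) zero u₀ (- 1ℚ) on-facet
    (trans (vanishes-at-origin u₀) (sym (+-inverseˡ 1ℚ)))
    where
    on-facet : ∀ b → b ≢ zero → u₀ · simplexVerts P b ≡ - 1ℚ
    on-facet zero    0≢0 = ⊥-elim (0≢0 refl)
    on-facet (suc k) _   = trans (u₀-dot _)
      (cong -_ (trans (Σ-cong n (λ l → QᵀP≡I l k)) (Σ-δ-column n k)))

  G : Matℚ n
  G k j = q k · q j

  G-symmetric : ∀ k j → G k j ≡ G j k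
  G-symmetric k j = Σ-cong n (λ m → *-comm (Q m k) (Q m j))

  G-off-diagonal : ∀ k j → k ≢ j → G k j < 0ℚ
  G-off-diagonal k j k≢j = acute (suc k) (suc j) (λ e → k≢j (suc-injective e))
    (q k) (q j) (q-normal k) (q-normal j)

  -- Acuteness for the facets opposite 0 and p_j: -Σ_k G_kj = u₀·q_j < 0.
  G-column-sums : ∀ j → 0ℚ < Σ n (λ k → G k j)
  G-column-sums j = subst (0ℚ <_) (neg-involutive (Σ n (λ k → G k j)))
    (subst (_< - - Σ n (λ k → G k j)) (neg-involutive 0ℚ) (neg-antimono-< u₀q<0))
    where
    neg-involutive : ∀ x → - - x ≡ x
    neg-involutive = solve 1 (λ x → :- (:- x) := x) refl
    u₀q<0 : - Σ n (λ k → G k j) < - 0ℚ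
    u₀q<0 = subst (_< 0ℚ) (u₀-dot (q j))
      (acute zero (suc j) (λ ()) u₀ (q j) u₀-normal (q-normal j))

  G-row-sums : ∀ k → 0ℚ < Σ n (λ j → G k j)
  G-row-sums k = subst (0ℚ <_) (Σ-cong n (λ j → G-symmetric j k)) (G-column-sums k)

  -- Q = P G, since P G = P Qᵀ Q = Q.
  Q≡PG : ∀ i j → Q i j ≡ Σ n (λ k → bℚ (P i k) * G k j)
  Q≡PG i j = sym (begin
    Σ n (λ k → bℚ (P i k) * Σ n (λ m → Q m k * Q m j))
      ≡⟨ Σ-cong n (λ k → Σ-*ˡ n (bℚ (P i k)) (λ m → Q m k * Q m j)) ⟨
    Σ n (λ k → Σ n (λ m → bℚ (P i k) * (Q m k * Q m j)))
      ≡⟨ Σ-cong n (λ k → Σ-cong n (λ m → *-assoc (bℚ (P i k)) (Q m k) (Q m j))) ⟨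
    Σ n (λ k → Σ n (λ m → (bℚ (P i k) * Q m k) * Q m j))
      ≡⟨ Σ-swap n n _ ⟩
    Σ n (λ m → Σ n (λ k → (bℚ (P i k) * Q m k) * Q m j))
      ≡⟨ Σ-cong n (λ m → trans (Σ-*ʳ n _ _) (cong (_* Q m j) (PQᵀ≡I i m))) ⟩
    Σ n (λ m → δ i m * Q m j)
      ≡⟨ Σ-δ n i (λ m → Q m j) ⟩
    Q i j ∎)

  open ZMatrixSigns G G-off-diagonal G-column-sums

  -- The sign pattern of Q; a row of P is nonzero since P Qᵀ = I.
  Q-pos : ∀ i j → P i j ≡ true → 0ℚ < Q i j
  Q-pos i j pij = subst (0ℚ <_) (sym (Q≡PG i j)) (combination-pos (P i) j pij)

  Q-neg : ∀ i j → P i j ≡ false → Q i j < 0ℚ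
  Q-neg i j pij =
    let (k₀ , pik₀) = row-has-one n (P i) (Q i) (trans (PQᵀ≡I i i) (δ-diag i))
    in subst (_< 0ℚ) (sym (Q≡PG i j)) (combination-neg (P i) j k₀ pij pik₀)

  -- Each row of Q has a nonnegative sum: Σ_j q_ij = Σ_k p_ik (Σ_j G_kj).
  Q-row-sum-nonneg : ∀ i → 0ℚ ≤ℚ Σ n (λ j → Q i j)
  Q-row-sum-nonneg i = subst (0ℚ ≤ℚ_) (sym row-sum)
    (Σ-nonneg n (λ k → bℚ-nonneg (P i k) (<⇒≤ (G-row-sums k))))
    where
    row-sum : Σ n (λ j → Q i j) ≡ Σ n (λ k → bℚ (P i k) * Σ n (λ j → G k j))
    row-sum = begin
      Σ n (λ j → Q i j)
        ≡⟨ Σ-cong n (Q≡PG i) ⟩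
      Σ n (λ j → Σ n (λ k → bℚ (P i k) * G k j))
        ≡⟨ Σ-swap n n _ ⟩
      Σ n (λ k → Σ n (λ j → bℚ (P i k) * G k j))
        ≡⟨ Σ-cong n (λ k → Σ-*ˡ n (bℚ (P i k)) (G k)) ⟩
      Σ n (λ k → bℚ (P i k) * Σ n (λ j → G k j)) ∎

  D≡P∘Q : ∀ i j → Dmat Q i j ≡ bℚ (P i j) * Q i j
  D≡P∘Q i j with P i j in pij
  ... | true  = trans (pos-part-of-pos (Q-pos i j pij)) (sym (*-identityˡ (Q i j)))
  ... | false = trans (pos-part-of-neg (Q-neg i j pij)) (sym (*-zeroˡ (Q i j)))

  D-row-sums : ∀ i → Σ n (λ j → Dmat Q i j) ≡ 1ℚ
  D-row-sums i = trans (Σ-cong n (D≡P∘Q i)) (trans (PQᵀ≡I i i) (δ-diag i))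

  D-column-sums : ∀ j → Σ n (λ i → Dmat Q i j) ≡ 1ℚ
  D-column-sums j = trans
    (Σ-cong n (λ i → trans (D≡P∘Q i j) (*-comm (bℚ (P i j)) (Q i j))))
    (trans (QᵀP≡I j j) (δ-diag j))

  -- Σ_j c_ij = Σ_j d_ij - Σ_j q_ij = 1 - Σ_j q_ij ≤ 1.
  C-row-sums : ∀ i → Σ n (λ j → Cmat Q i j) ≤ℚ 1ℚ
  C-row-sums i = subst (_≤ℚ 1ℚ) (sym row-sum)
    (subst (1ℚ - Σ n (Q i) ≤ℚ_) (+-identityʳ 1ℚ)
      (+-monoʳ-≤ 1ℚ (neg-antimono-≤ (Q-row-sum-nonneg i))))
    where
    row-sum : Σ n (λ j → Cmat Q i j) ≡ 1ℚ - Σ n (Q i)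
    row-sum = begin
      Σ n (λ j → Cmat Q i j)                   ≡⟨ Σ-cong n (λ j → neg-part≡pos-part-minus (Q i j)) ⟩
      Σ n (λ j → Dmat Q i j - Q i j)           ≡⟨ Σ-- n _ _ ⟩
      Σ n (λ j → Dmat Q i j) - Σ n (Q i)       ≡⟨ cong (_- Σ n (Q i)) (D-row-sums i) ⟩
      1ℚ - Σ n (Q i) ∎

theorem3p1 : (n : ℕ) → 1 ≤ n → (P : Fin n → Fin n → Bool) → (Q : Matℚ n) →
    IsInvTranspose P Q → Acute (simplexVerts P) →
    ((i j : Fin n) → ((0ℚ < Q i j) ⇔ (P i j ≡ true)) × ((Q i j < 0ℚ) ⇔ (P i j ≡ false))) ×
    ((i j : Fin n) → Q i j ≡ Dmat Q i j - Cmat Q i j) ×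
    DoublyStochastic (Dmat Q) × RowSubstochastic (Cmat Q)
theorem3p1 n _ P Q inverse acute =
  (λ i j → sign-pattern (P i j) (Q i j) (Q-pos i j) (Q-neg i j)) ,
  (λ i j → pos-neg-decomposition (Q i j)) ,
  ((λ i j → pos-part-nonneg (Q i j)) , D-row-sums , D-column-sums) ,
  ((λ i j → neg-part-nonneg (Q i j)) , C-row-sums)
  where open AcuteZeroOneSimplex n P Q inverse acute
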